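{- Let $k,\ell\ge1$, $\vec r\in\mathbb Z_{\ge1}^k$, $\vec s\in\mathbb Z_{\ge1}^\ell$, $\vec t\in\mathbb Z_{\ge1}^{k+\ell}$ with $|\vec r|+|\vec s|=|\vec t|$, and $(\varphi,\psi)\in I_{k,\ell}$. (1) Let $a,b$ be integers with $a<\min(t_1,r_1)$ and $b<\min(t_1,s_1)$. Then for all $i\in\{2,\dots,k+\ell\}$, $c_{\vec r-a\vec e_1,\vec s}^{\vec t-a\vec e_1,(\varphi,\psi)}(i)=c_{\vec r,\vec s}^{\vec t,(\varphi,\psi)}(i)$ and $c_{\vec r,\vec s-b\vec e_1}^{\vec t-b\vec e_1,(\varphi,\psi)}(i)=c_{\vec r,\vec s}^{\vec t,(\varphi,\psi)}(i)$. (2) If $\varphi(1)=1$ and $r_1=t_1=1$, then $c_{\vec r,\vec s}^{\vec t,(\varphi,\psi)}(i+1)=c_{\vec r\,',\vec s}^{\vec t\,',(\check\varphi,\bar\psi)}(i)$ for $1\le i\le k+\ell-1$. If $\psi(1)=1$ and $s_1=t_1=1$, then $c_{\vec r,\vec s}^{\vec t,(\varphi,\psi)}(i+1)=c_{\vec r,\vec s\,'}^{\vec t\,',(\bar\varphi,\check\psi)}(i)$ for $1\le i\le k+\ell-1$.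
   Context: For $m\ge0$, $[m]=\{1,\dots,m\}$ ($[0]=\emptyset$); $|\vec x|$ is the sum of entries; $\mathbb Z_{\ge1}^0$ consists of the single empty vector, of sum $0$. For integers $k,\ell\ge0$ not both zero, $I_{k,\ell}$ is the set of pairs $(\varphi,\psi)$ of order-preserving injective maps $\varphi:[k]\to[k+\ell]$, $\psi:[\ell]\to[k+\ell]$ with $\mathrm{im}\,\varphi\sqcup\mathrm{im}\,\psi=[k+\ell]$ (maps from $[0]$ are empty). For $\vec r\in\mathbb Z_{\ge1}^k$, $\vec s\in\mathbb Z_{\ge1}^\ell$, $\vec t\in\mathbb Z_{\ge1}^{k+\ell}$ with $|\vec t|=|\vec r|+|\vec s|$ and $(\varphi,\psi)\in I_{k,\ell}$: $h_i=r_j$ if $i=\varphi(j)$, $h_i=s_j$ if $i=\psi(j)$; $\varepsilon(i)=1$ if $i\in\mathrm{im}\,\varphi$, else $-1$; $c_{\vec r,\vec s}^{\vec t,(\varphi,\psi)}(i)=\binom{t_i-1}{h_i-1}$ if $i=1$ or ($i\ge2$ and $\varepsilon(i)=\varepsilon(i-1)$), and $=\binom{t_i-1}{\sum_{j\le i}t_j-\sum_{j\le i}h_j}$ if $i\ge2$ and $\varepsilon(i)\ne\varepsilon(i-1)$; for integers $a\ge0,b$, $\binom ab$ is the usual binomial coefficient when $0\le b\le a$ and $0$ otherwise. $\vec e_1=(1,0,\dots,0)$ of the appropriate length, so $\vec x-a\vec e_1=(x_1-a,x_2,\dots)$. For $\vec x=(x_1,\dots,x_m)$, $\vec x\,'=(x_2,\dots,x_m)$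 (the empty vector if $m=1$). For a function $f$ on $[m]$: $\check f(x)=f(x+1)-1$ on $[m-1]$ (empty if $m=1$) and $\bar f(x)=f(x)-1$ on $[m]$. -}

module Defs where

open import Data.Nat as ℕ using (ℕ; zero; suc; _∸_)
open import Data.Nat.Combinatorics using (_C_)
open import Data.Integer as ℤ using (ℤ; +_; -[1+_]; _-_; _+_)
open import Data.Bool using (Bool; true; false; if_then_else_)
open import Data.Maybe using (Maybe; just; nothing; is-just)
open import Data.Product using (_×_; ∃; _,_)
open import Data.Sum using (_⊎_)
open import Relation.Binary.PropositionalEquality using (_≡_; _≢_)
open import Relation.Nullary using (yes; no)
open import Relation.Nullary.Decidable using (⌊_⌋)

-- Conventions (1-based, as in the paper):
--   a vector x ∈ ℤ^m is a function x : ℕ → ℤ whose entries x 1, …, x m matter;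
--   a map f : [m] → [n] is a function f : ℕ → ℕ whose values f 1, …, f m matter.

binom : ℤ → ℤ → ℕ
binom (+ a) (+ b) = if ⌊ b ℕ.≤? a ⌋ then a C b else 0
binom (+ a) -[1+ b ] = 0
binom -[1+ a ] b = 0

psum : (ℕ → ℤ) → ℕ → ℤ
psum x zero = + 0
psum x (suc i) = psum x i + x (suc i)

Pos : ℕ → (ℕ → ℤ) → Set
Pos m x = ∀ j → 1 ℕ.≤ j → j ℕ.≤ m → + 1 ℤ.≤ x j

IsOPInj : ℕ → ℕ → (ℕ → ℕ) → Set
IsOPInj m n f =
  (∀ j → 1 ℕ.≤ j → j ℕ.≤ m → 1 ℕ.≤ f j × f j ℕ.≤ n) ×
  (∀ j j′ → 1 ℕ.≤ j → j ℕ.< j′ → j′ ℕ.≤ m → f j ℕ.< f j′)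

InI : ℕ → ℕ → (ℕ → ℕ) → (ℕ → ℕ) → Set
InI k ℓ φ ψ =
  IsOPInj k (k ℕ.+ ℓ) φ × IsOPInj ℓ (k ℕ.+ ℓ) ψ ×
  (∀ j j′ → 1 ℕ.≤ j → j ℕ.≤ k → 1 ℕ.≤ j′ → j′ ℕ.≤ ℓ → φ j ≢ ψ j′) ×
  (∀ i → 1 ℕ.≤ i → i ℕ.≤ k ℕ.+ ℓ →
     (∃ λ j → 1 ℕ.≤ j × j ℕ.≤ k × φ j ≡ i) ⊎ (∃ λ j → 1 ℕ.≤ j × j ℕ.≤ ℓ × ψ j ≡ i))

preim : ℕ → (ℕ → ℕ) → ℕ → Maybe ℕ
preim zero f i = nothing
preim (suc m) f i with f (suc m) ℕ.≟ i
... | yes _ = just (suc m)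
... | no _ = preim m f i

-- h_i (for (φ,ψ) ∈ I_{k,ℓ} the preimage is unique, so this is the paper's h)
hvec : ℕ → ℕ → (ℕ → ℤ) → (ℕ → ℤ) → (ℕ → ℕ) → (ℕ → ℕ) → ℕ → ℤ
hvec k ℓ r s φ ψ i with preim k φ i
... | just j = r j
... | nothing with preim ℓ ψ i
...   | just j = s j
...   | nothing = + 0

eps : ℕ → (ℕ → ℕ) → ℕ → Bool
eps k φ i = is-just (preim k φ i)

-- c_{r,s}^{t,(φ,ψ)}(i) for i ∈ [k+ℓ]  (value at i = 0 is an irrelevant junk 0)
coef : (k ℓ : ℕ) (r s t : ℕ → ℤ) (φ ψ : ℕ → ℕ) → ℕ → ℕ
coef k ℓ r s t φ ψ zero = 0
coef k ℓ r s t φ ψ (suc zero) =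
  binom (t 1 - + 1) (hvec k ℓ r s φ ψ 1 - + 1)
coef k ℓ r s t φ ψ (suc (suc i)) =
  if eqB (eps k φ (suc (suc i))) (eps k φ (suc i))
  then binom (t (suc (suc i)) - + 1) (hvec k ℓ r s φ ψ (suc (suc i)) - + 1)
  else binom (t (suc (suc i)) - + 1)
             (psum t (suc (suc i)) - psum (hvec k ℓ r s φ ψ) (suc (suc i)))
  where
  eqB : Bool → Bool → Bool
  eqB true true = true
  eqB false false = true
  eqB _ _ = false

subE1 : (ℕ → ℤ) → ℤ → ℕ → ℤ
subE1 x a (suc zero) = x 1 - a
subE1 x a j = x j

tailV : (ℕ → ℤ) → ℕ → ℤ
tailV x j = x (suc j)

checkM : (ℕ → ℕ) → ℕ → ℕ
checkM f x = f (suc x) ∸ 1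

barM : (ℕ → ℕ) → ℕ → ℕ
barM f x = f x ∸ 1

-- Subtracting a from r₁ and t₁ changes h only at φ(1), and ε switches
-- there (all positions before φ(1) lie in im ψ); so at any i ≥ 2 either the non-switching formula
-- reads unchanged entries, or i ≥ φ(1) and both prefix sums drop by a. The same holds for s₁ and
-- ψ(1), where ε switches from true to false. Deleting a first position with t₁ = h₁ = 1 shifts
-- every ingredient by one; the only new case is the switching formula at i = 2, which equals the
-- non-switching one by the symmetry binom(n, n − m) = binom(n, m).
{-# OPTIONS --safe #-}
module Submission where

open import Defs
open import Data.Nat using (ℕ; _≤_; _+_; _∸_)
open import Data.Integer using (ℤ; +_; _<_; _⊓_) renaming (_+_ to _+ℤ_)
open import Data.Product using (_×_)
open import Relation.Binary.PropositionalEquality using (_≡_)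

open import Data.Nat as ℕ using (zero; suc; z≤n; s≤s; _≟_)
import Data.Nat.Properties as ℕ
open import Data.Nat.Combinatorics using (_C_; nCk≡nC[n∸k])
open import Data.Integer using (-[1+_]; _-_; -_)
import Data.Integer.Properties as ℤ
open import Data.Integer.Tactic.RingSolver using (solve-∀)
open import Data.Bool using (Bool; true; false; not)
open import Data.Bool.Properties using (not-¬) renaming (_≟_ to _≟ᵇ_)
open import Data.Maybe using (Maybe; just; nothing; is-just) renaming (map to mapMaybe)
open import Data.Product using (_,_; proj₁; proj₂)
open import Data.Sum using (inj₁; inj₂)
open import Data.Empty using (⊥-elim)
open import Function using (_⇔_; mk⇔; Equivalence)
open import Relation.Nullary using (¬_; yes; no; Dec)
open import Relation.Binary.PropositionalEquality
  using (_≢_; refl; sym; trans; cong; cong₂; subst; module ≡-Reasoning)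

StrictlyIncreasing : ℕ → (ℕ → ℕ) → Set
StrictlyIncreasing m f = ∀ j j′ → 1 ≤ j → j ℕ.< j′ → j′ ≤ m → f j ℕ.< f j′

increasing-≥-first : ∀ {m f} → StrictlyIncreasing m f → ∀ j → 1 ≤ j → j ≤ m → f 1 ≤ f j
increasing-≥-first inc (suc zero) _ _ = ℕ.≤-refl
increasing-≥-first inc (suc (suc j)) _ j≤m =
  ℕ.<⇒≤ (inc 1 (suc (suc j)) (s≤s z≤n) (s≤s (s≤s z≤n)) j≤m)

preim-sound : ∀ m f x {j} → preim m f x ≡ just j → 1 ≤ j × j ≤ m × f j ≡ x
preim-sound (suc m) f x eq with f (suc m) ≟ x
preim-sound (suc m) f x refl | yes fm≡x = s≤s z≤n , ℕ.≤-refl , fm≡x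
... | no _ with preim-sound m f x eq
...   | 1≤j , j≤m , fj≡x = 1≤j , ℕ.m≤n⇒m≤1+n j≤m , fj≡x

preim-complete : ∀ m f x j → 1 ≤ j → j ≤ m → f j ≡ x → is-just (preim m f x) ≡ true
preim-complete zero f x (suc j) 1≤j () fj≡x
preim-complete (suc m) f x j 1≤j j≤m fj≡x with f (suc m) ≟ x
... | yes _ = refl
... | no fm≢x with j ≟ suc m
...   | yes refl = ⊥-elim (fm≢x fj≡x)
...   | no j≢m = preim-complete m f x j 1≤j (ℕ.≤-pred (ℕ.≤∧≢⇒< j≤m j≢m)) fj≡x

preim-nothing : ∀ m f x → (∀ j → 1 ≤ j → j ≤ m → f j ≢ x) → preim m f x ≡ nothing
preim-nothing m f x ∉im with preim m f x in eq
... | nothing = refl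
... | just j with preim-sound m f x eq
...   | 1≤j , j≤m , fj≡x = ⊥-elim (∉im j 1≤j j≤m fj≡x)

preim-image : ∀ m f → StrictlyIncreasing m f →
  ∀ j → 1 ≤ j → j ≤ m → preim m f (f j) ≡ just j
preim-image zero f inc (suc j) 1≤j ()
preim-image (suc m) f inc j 1≤j j≤m with f (suc m) ≟ f j | j ℕ.<? suc m
... | yes fm≡fj | yes j<m =
  ⊥-elim (ℕ.<-irrefl (sym fm≡fj) (inc j (suc m) 1≤j j<m ℕ.≤-refl))
... | yes _     | no j≮m  = cong just (ℕ.≤-antisym (ℕ.≮⇒≥ j≮m) j≤m)
... | no fm≢fj  | yes j<m =
  preim-image m f (λ a b 1≤a a<b b≤m → inc a b 1≤a a<b (ℕ.m≤n⇒m≤1+n b≤m)) j 1≤j (ℕ.≤-pred j<m)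
... | no fm≢fj  | no j≮m  = ⊥-elim (fm≢fj (cong f (ℕ.≤-antisym (ℕ.≮⇒≥ j≮m) j≤m)))

preim-cong : ∀ m f g x y → (∀ j → f j ≡ x ⇔ g j ≡ y) → preim m f x ≡ preim m g y
preim-cong zero f g x y same = refl
preim-cong (suc m) f g x y same with f (suc m) ≟ x | g (suc m) ≟ y
... | yes _  | yes _  = refl
... | yes fx | no ¬gy = ⊥-elim (¬gy (Equivalence.to (same (suc m)) fx))
... | no ¬fx | yes gy = ⊥-elim (¬fx (Equivalence.from (same (suc m)) gy))
... | no _   | no _   = preim-cong m f g x y same

preim-pred : ∀ m f j → 1 ≤ j → preim m (λ x → f x ∸ 1) j ≡ preim m f (suc j)
preim-pred m f (suc j) _ =
  preim-cong m _ f (suc j) (suc (suc j)) λ x → mk⇔ (to (f x)) (cong (_∸ 1))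
  where
  to : ∀ y → y ∸ 1 ≡ suc j → y ≡ suc (suc j)
  to (suc y) = cong suc

preim-suc : ∀ m f y → f 1 ≢ y → preim (suc m) f y ≡ mapMaybe suc (preim m (λ j → f (suc j)) y)
preim-suc zero f y f1≢y with f 1 ≟ y
... | yes f1≡y = ⊥-elim (f1≢y f1≡y)
... | no _ = refl
preim-suc (suc m) f y f1≢y with f (suc (suc m)) ≟ y
... | yes _ = refl
... | no _ = preim-suc m f y f1≢y

preim-drop-first : ∀ m f j → f 1 ≡ 1 → 1 ≤ j →
  preim (suc m) f (suc j) ≡ mapMaybe suc (preim m (checkM f) j)
preim-drop-first m f (suc j) f₁≡1 _ =
  trans (preim-suc m f (suc (suc j)) (λ f₁≡2+j → 1≢2+j (trans (sym f₁≡1) f₁≡2+j)))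
        (cong (mapMaybe suc) (sym (preim-pred m (λ x → f (suc x)) (suc j) (s≤s z≤n))))
  where
  1≢2+j : 1 ≢ suc (suc j)
  1≢2+j ()

is-just-map-suc : ∀ P → is-just (mapMaybe suc P) ≡ is-just P
is-just-map-suc (just _) = refl
is-just-map-suc nothing = refl

eps-drop-φ₁ : ∀ k φ → φ 1 ≡ 1 → ∀ j → 1 ≤ j → eps k (checkM φ) j ≡ eps (suc k) φ (suc j)
eps-drop-φ₁ k φ φ₁≡1 j 1≤j =
  sym (trans (cong is-just (preim-drop-first k φ j φ₁≡1 1≤j)) (is-just-map-suc _))

eps-drop-ψ₁ : ∀ k φ j → 1 ≤ j → eps k (barM φ) j ≡ eps k φ (suc j)
eps-drop-ψ₁ k φ j 1≤j = cong is-just (preim-pred k φ j 1≤j)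

select : (ℕ → ℤ) → (ℕ → ℤ) → Maybe ℕ → Maybe ℕ → ℤ
select r s (just j) _        = r j
select r s nothing (just j)  = s j
select r s nothing nothing   = + 0

hvec≡select : ∀ k ℓ r s φ ψ i → hvec k ℓ r s φ ψ i ≡ select r s (preim k φ i) (preim ℓ ψ i)
hvec≡select k ℓ r s φ ψ i with preim k φ i
... | just _ = refl
... | nothing with preim ℓ ψ i
...   | just _ = refl
...   | nothing = refl

select-sucˡ : ∀ r s P Q → select r s (mapMaybe suc P) Q ≡ select (tailV r) s P Q
select-sucˡ r s (just _) Q = refl
select-sucˡ r s nothing (just _) = refl
select-sucˡ r s nothing nothing = refl

select-sucʳ : ∀ r s P Q → select r s P (mapMaybe suc Q) ≡ select r (tailV s) P Q
select-sucʳ r s (just _) Q = refl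
select-sucʳ r s nothing (just _) = refl
select-sucʳ r s nothing nothing = refl

select-congˡ : ∀ {r r′} s P Q → (∀ j → P ≡ just j → r′ j ≡ r j) →
  select r′ s P Q ≡ select r s P Q
select-congˡ s (just j) Q r′≗r = r′≗r j refl
select-congˡ s nothing (just _) r′≗r = refl
select-congˡ s nothing nothing r′≗r = refl

select-congʳ : ∀ {s s′} r P Q → (∀ j → Q ≡ just j → s′ j ≡ s j) →
  select r s′ P Q ≡ select r s P Q
select-congʳ r (just _) Q s′≗s = refl
select-congʳ r nothing (just j) s′≗s = s′≗s j refl
select-congʳ r nothing nothing s′≗s = refl

hvec-at-φ : ∀ k ℓ r s φ ψ {x j} → preim k φ x ≡ just j → hvec k ℓ r s φ ψ x ≡ r j
hvec-at-φ k ℓ r s φ ψ {x} eq =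
  trans (hvec≡select k ℓ r s φ ψ x) (cong (λ P → select r s P (preim ℓ ψ x)) eq)

hvec-at-ψ : ∀ k ℓ r s φ ψ {x j} → preim k φ x ≡ nothing → preim ℓ ψ x ≡ just j →
  hvec k ℓ r s φ ψ x ≡ s j
hvec-at-ψ k ℓ r s φ ψ {x} eq eq′ =
  trans (hvec≡select k ℓ r s φ ψ x) (cong₂ (select r s) eq eq′)

hvec-cong-r : ∀ k ℓ {r r′} s φ ψ x → (∀ j → 1 ≤ j → j ≤ k → φ j ≡ x → r′ j ≡ r j) →
  hvec k ℓ r′ s φ ψ x ≡ hvec k ℓ r s φ ψ x
hvec-cong-r k ℓ {r} {r′} s φ ψ x r′≗r = begin
  hvec k ℓ r′ s φ ψ x                     ≡⟨ hvec≡select k ℓ r′ s φ ψ x ⟩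
  select r′ s (preim k φ x) (preim ℓ ψ x) ≡⟨ select-congˡ s _ (preim ℓ ψ x) agree ⟩
  select r s (preim k φ x) (preim ℓ ψ x)  ≡⟨ hvec≡select k ℓ r s φ ψ x ⟨
  hvec k ℓ r s φ ψ x                      ∎
  where
  open ≡-Reasoning
  agree : ∀ j → preim k φ x ≡ just j → r′ j ≡ r j
  agree j eq with preim-sound k φ x eq
  ... | 1≤j , j≤k , φj≡x = r′≗r j 1≤j j≤k φj≡x

hvec-cong-s : ∀ k ℓ r {s s′} φ ψ x → (∀ j → 1 ≤ j → j ≤ ℓ → ψ j ≡ x → s′ j ≡ s j) →
  hvec k ℓ r s′ φ ψ x ≡ hvec k ℓ r s φ ψ x
hvec-cong-s k ℓ r {s} {s′} φ ψ x s′≗s = begin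
  hvec k ℓ r s′ φ ψ x                     ≡⟨ hvec≡select k ℓ r s′ φ ψ x ⟩
  select r s′ (preim k φ x) (preim ℓ ψ x) ≡⟨ select-congʳ r (preim k φ x) _ agree ⟩
  select r s (preim k φ x) (preim ℓ ψ x)  ≡⟨ hvec≡select k ℓ r s φ ψ x ⟨
  hvec k ℓ r s φ ψ x                      ∎
  where
  open ≡-Reasoning
  agree : ∀ j → preim ℓ ψ x ≡ just j → s′ j ≡ s j
  agree j eq with preim-sound ℓ ψ x eq
  ... | 1≤j , j≤ℓ , ψj≡x = s′≗s j 1≤j j≤ℓ ψj≡x

hvec-drop-φ₁ : ∀ k ℓ r s φ ψ → φ 1 ≡ 1 → ∀ j → 1 ≤ j →
  hvec k ℓ (tailV r) s (checkM φ) (barM ψ) j ≡ hvec (suc k) ℓ r s φ ψ (suc j)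
hvec-drop-φ₁ k ℓ r s φ ψ φ₁≡1 j 1≤j = begin
  hvec k ℓ (tailV r) s (checkM φ) (barM ψ) j
    ≡⟨ hvec≡select k ℓ (tailV r) s (checkM φ) (barM ψ) j ⟩
  select (tailV r) s (preim k (checkM φ) j) (preim ℓ (barM ψ) j)
    ≡⟨ cong (select (tailV r) s (preim k (checkM φ) j)) (preim-pred ℓ ψ j 1≤j) ⟩
  select (tailV r) s (preim k (checkM φ) j) (preim ℓ ψ (suc j))
    ≡⟨ select-sucˡ r s (preim k (checkM φ) j) (preim ℓ ψ (suc j)) ⟨
  select r s (mapMaybe suc (preim k (checkM φ) j)) (preim ℓ ψ (suc j))
    ≡⟨ cong (λ P → select r s P (preim ℓ ψ (suc j))) (preim-drop-first k φ j φ₁≡1 1≤j) ⟨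
  select r s (preim (suc k) φ (suc j)) (preim ℓ ψ (suc j))
    ≡⟨ hvec≡select (suc k) ℓ r s φ ψ (suc j) ⟨
  hvec (suc k) ℓ r s φ ψ (suc j) ∎
  where open ≡-Reasoning

hvec-drop-ψ₁ : ∀ k ℓ r s φ ψ → ψ 1 ≡ 1 → ∀ j → 1 ≤ j →
  hvec k ℓ r (tailV s) (barM φ) (checkM ψ) j ≡ hvec k (suc ℓ) r s φ ψ (suc j)
hvec-drop-ψ₁ k ℓ r s φ ψ ψ₁≡1 j 1≤j = begin
  hvec k ℓ r (tailV s) (barM φ) (checkM ψ) j
    ≡⟨ hvec≡select k ℓ r (tailV s) (barM φ) (checkM ψ) j ⟩
  select r (tailV s) (preim k (barM φ) j) (preim ℓ (checkM ψ) j)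
    ≡⟨ cong (λ P → select r (tailV s) P (preim ℓ (checkM ψ) j)) (preim-pred k φ j 1≤j) ⟩
  select r (tailV s) (preim k φ (suc j)) (preim ℓ (checkM ψ) j)
    ≡⟨ select-sucʳ r s (preim k φ (suc j)) (preim ℓ (checkM ψ) j) ⟨
  select r s (preim k φ (suc j)) (mapMaybe suc (preim ℓ (checkM ψ) j))
    ≡⟨ cong (select r s (preim k φ (suc j))) (preim-drop-first ℓ ψ j ψ₁≡1 1≤j) ⟨
  select r s (preim k φ (suc j)) (preim (suc ℓ) ψ (suc j))
    ≡⟨ hvec≡select k (suc ℓ) r s φ ψ (suc j) ⟨
  hvec k (suc ℓ) r s φ ψ (suc j) ∎
  where open ≡-Reasoning

SubAt : ℕ → ℤ → (ℕ → ℤ) → (ℕ → ℤ) → Set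
SubAt c a f g = (∀ x → x ≢ c → g x ≡ f x) × g c ≡ f c - a

subE1-SubAt : ∀ x a → SubAt 1 a x (subE1 x a)
subE1-SubAt x a = away , refl
  where
  away : ∀ j → j ≢ 1 → subE1 x a j ≡ x j
  away zero _ = refl
  away (suc zero) j≢1 = ⊥-elim (j≢1 refl)
  away (suc (suc _)) _ = refl

psum-SubAt-< : ∀ {c a f g} → SubAt c a f g → ∀ i → i ℕ.< c → psum g i ≡ psum f i
psum-SubAt-< sub zero _ = refl
psum-SubAt-< sub (suc i) i<c =
  cong₂ _+ℤ_ (psum-SubAt-< sub i (ℕ.<-trans (ℕ.n<1+n i) i<c)) (proj₁ sub (suc i) (ℕ.<⇒≢ i<c))

psum-SubAt-≥ : ∀ {c a f g} → SubAt c a f g → 1 ≤ c → ∀ i → c ≤ i → psum g i ≡ psum f i - a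
psum-SubAt-≥ sub 1≤c zero c≤0 = ⊥-elim (ℕ.<-irrefl refl (ℕ.<-≤-trans 1≤c c≤0))
psum-SubAt-≥ {c} {a} {f} sub 1≤c (suc i) c≤i with suc i ≟ c
... | yes refl = trans (cong₂ _+ℤ_ (psum-SubAt-< sub i ℕ.≤-refl) (proj₂ sub))
                       (sym (ℤ.+-assoc (psum f i) (f (suc i)) (- a)))
... | no i≢c = trans (cong₂ _+ℤ_ (psum-SubAt-≥ sub 1≤c i c≤i′) (proj₁ sub (suc i) i≢c))
                     (shift (psum f i) (f (suc i)) a)
  where
  c≤i′ : c ≤ i
  c≤i′ = ℕ.≤-pred (ℕ.≤∧≢⇒< c≤i (λ c≡i → i≢c (sym c≡i)))
  shift : ∀ P F a → (P - a) +ℤ F ≡ (P +ℤ F) - a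
  shift = solve-∀

psum-suc : ∀ f n → psum f (suc n) ≡ f 1 +ℤ psum (tailV f) n
psum-suc f zero = ℤ.+-comm (+ 0) (f 1)
psum-suc f (suc n) = trans (cong (_+ℤ f (suc (suc n))) (psum-suc f n))
                           (ℤ.+-assoc (f 1) (psum (tailV f) n) (f (suc (suc n))))

psum-cong : ∀ {f g} → (∀ j → 1 ≤ j → f j ≡ g j) → ∀ n → psum f n ≡ psum g n
psum-cong f≗g zero = refl
psum-cong f≗g (suc n) = cong₂ _+ℤ_ (psum-cong f≗g n) (f≗g (suc n) (s≤s z≤n))

binom-in : ∀ {a b} → b ≤ a → binom (+ a) (+ b) ≡ a C b
binom-in {a} {b} b≤a with b ℕ.≤? a
... | yes _ = refl
... | no b≰a = ⊥-elim (b≰a b≤a)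

binom-out : ∀ {a b} → ¬ b ≤ a → binom (+ a) (+ b) ≡ 0
binom-out {a} {b} b≰a with b ℕ.≤? a
... | yes b≤a = ⊥-elim (b≰a b≤a)
... | no _ = refl

binom-sym : ∀ a b → binom a (a - b) ≡ binom a b
binom-sym -[1+ a ] b = refl
binom-sym (+ a) -[1+ b ] = binom-out (λ a+1+b≤a → ℕ.m+1+n≰m a a+1+b≤a)
binom-sym (+ a) (+ b) = by-cases (b ℕ.≤? a)
  where
  open ≡-Reasoning
  negative : ∀ n → n ≢ 0 → binom (+ a) (- + n) ≡ 0
  negative zero n≢0 = ⊥-elim (n≢0 refl)
  negative (suc n) _ = refl
  by-cases : Dec (b ≤ a) → binom (+ a) (+ a - + b) ≡ binom (+ a) (+ b)
  by-cases (yes b≤a) = begin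
    binom (+ a) (+ a - + b)   ≡⟨ cong (binom (+ a)) (trans (ℤ.m-n≡m⊖n a b) (ℤ.⊖-≥ b≤a)) ⟩
    binom (+ a) (+ (a ∸ b))   ≡⟨ binom-in (ℕ.m∸n≤m a b) ⟩
    a C (a ∸ b)               ≡⟨ nCk≡nC[n∸k] b≤a ⟨
    a C b                     ≡⟨ binom-in b≤a ⟨
    binom (+ a) (+ b)         ∎
  by-cases (no b≰a) = begin
    binom (+ a) (+ a - + b)
      ≡⟨ cong (binom (+ a)) (trans (ℤ.m-n≡m⊖n a b) (ℤ.⊖-< (ℕ.≰⇒> b≰a))) ⟩
    binom (+ a) (- + (b ∸ a)) ≡⟨ negative (b ∸ a) (λ b∸a≡0 → b≰a (ℕ.m∸n≡0⇒m≤n b∸a≡0)) ⟩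
    0                         ≡⟨ binom-out b≰a ⟨
    binom (+ a) (+ b)         ∎

module _ (k ℓ : ℕ) (r s t : ℕ → ℤ) (φ ψ : ℕ → ℕ) (m : ℕ) where

  private
    i = suc (suc m)
    h = hvec k ℓ r s φ ψ

  coef-same : eps k φ i ≡ eps k φ (suc m) →
    coef k ℓ r s t φ ψ i ≡ binom (t i - + 1) (h i - + 1)
  coef-same ε≡ with eps k φ i | eps k φ (suc m)
  coef-same refl | true  | true  = refl
  coef-same refl | false | false = refl

  coef-switch : eps k φ i ≢ eps k φ (suc m) →
    coef k ℓ r s t φ ψ i ≡ binom (t i - + 1) (psum t i - psum h i)
  coef-switch ε≢ with eps k φ i | eps k φ (suc m)
  ... | true  | true  = ⊥-elim (ε≢ refl)
  ... | false | false = ⊥-elim (ε≢ refl)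
  ... | true  | false = refl
  ... | false | true  = refl

SwitchesAt : (ℕ → Bool) → Bool → ℕ → Set
SwitchesAt ε b c = (∀ i → 1 ≤ i → i ℕ.< c → ε i ≡ b) × ε c ≡ not b

coef-SubAt : ∀ k ℓ φ ψ t {r s r′ s′ a c b} → 1 ≤ c →
  SubAt c a (hvec k ℓ r s φ ψ) (hvec k ℓ r′ s′ φ ψ) → SwitchesAt (eps k φ) b c →
  ∀ m → coef k ℓ r′ s′ (subE1 t a) φ ψ (2 + m) ≡ coef k ℓ r s t φ ψ (2 + m)
coef-SubAt k ℓ φ ψ t {r} {s} {r′} {s′} {a} {c} {b} 1≤c sub (below , at) m
  with eps k φ (2 + m) ≟ᵇ eps k φ (1 + m)
... | yes ε≡ = trans (coef-same k ℓ r′ s′ (subE1 t a) φ ψ m ε≡)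
               (trans (cong (λ x → binom (t (2 + m) - + 1) (x - + 1)) (proj₁ sub (2 + m) i≢c))
                      (sym (coef-same k ℓ r s t φ ψ m ε≡)))
  where
  i≢c : 2 + m ≢ c
  i≢c refl = not-¬ (below (1 + m) (s≤s z≤n) ℕ.≤-refl) (trans (sym ε≡) at)
... | no ε≢ = trans (coef-switch k ℓ r′ s′ (subE1 t a) φ ψ m ε≢)
              (trans (cong (binom (t (2 + m) - + 1)) psum-diff) (sym (coef-switch k ℓ r s t φ ψ m ε≢)))
  where
  h = hvec k ℓ r s φ ψ
  c≤i : c ≤ 2 + m
  c≤i with c ℕ.≤? 2 + m
  ... | yes c≤i = c≤i
  ... | no c≰i = ⊥-elim (ε≢ (trans (below (2 + m) (s≤s z≤n) i<c)
                                   (sym (below (1 + m) (s≤s z≤n) (ℕ.<-trans (ℕ.n<1+n _) i<c)))))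
    where i<c = ℕ.≰⇒> c≰i
  psum-t : psum (subE1 t a) (2 + m) ≡ psum t (2 + m) - a
  psum-t = psum-SubAt-≥ (subE1-SubAt t a) (s≤s z≤n) (2 + m) (s≤s z≤n)
  psum-h : psum (hvec k ℓ r′ s′ φ ψ) (2 + m) ≡ psum h (2 + m) - a
  psum-h = psum-SubAt-≥ sub 1≤c (2 + m) c≤i
  cancel : ∀ T H a → (T - a) - (H - a) ≡ T - H
  cancel = solve-∀
  psum-diff : psum (subE1 t a) (2 + m) - psum (hvec k ℓ r′ s′ φ ψ) (2 + m)
            ≡ psum t (2 + m) - psum h (2 + m)
  psum-diff = trans (cong₂ _-_ psum-t psum-h) (cancel (psum t (2 + m)) (psum h (2 + m)) a)

coef-two : ∀ {k ℓ r s t φ ψ} → hvec k ℓ r s φ ψ 1 ≡ + 1 → t 1 ≡ + 1 →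
  coef k ℓ r s t φ ψ 2 ≡ binom (t 2 - + 1) (hvec k ℓ r s φ ψ 2 - + 1)
coef-two {k} {ℓ} {r} {s} {t} {φ} {ψ} h₁≡1 t₁≡1 with eps k φ 2 ≟ᵇ eps k φ 1
... | yes ε≡ = coef-same k ℓ r s t φ ψ 0 ε≡
... | no ε≢ = begin
  coef k ℓ r s t φ ψ 2                          ≡⟨ coef-switch k ℓ r s t φ ψ 0 ε≢ ⟩
  binom (t 2 - + 1) (psum t 2 - psum h 2)       ≡⟨ cong (binom (t 2 - + 1)) psum-diff ⟩
  binom (t 2 - + 1) ((t 2 - + 1) - (h 2 - + 1)) ≡⟨ binom-sym (t 2 - + 1) (h 2 - + 1) ⟩
  binom (t 2 - + 1) (h 2 - + 1)                 ∎
  where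
  open ≡-Reasoning
  h = hvec k ℓ r s φ ψ
  shift : ∀ u x y → ((+ 0 +ℤ u) +ℤ x) - ((+ 0 +ℤ u) +ℤ y) ≡ (x - u) - (y - u)
  shift = solve-∀
  psum-diff : psum t 2 - psum h 2 ≡ (t 2 - + 1) - (h 2 - + 1)
  psum-diff rewrite t₁≡1 | h₁≡1 = shift (+ 1) (t 2) (h 2)

coef-drop-first : ∀ k ℓ φ ψ k′ ℓ′ φ′ ψ′ t {r s r′ s′} →
  hvec k ℓ r s φ ψ 1 ≡ + 1 → t 1 ≡ + 1 →
  (∀ j → 1 ≤ j → hvec k′ ℓ′ r′ s′ φ′ ψ′ j ≡ hvec k ℓ r s φ ψ (suc j)) →
  (∀ j → 1 ≤ j → eps k′ φ′ j ≡ eps k φ (suc j)) →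
  ∀ m → coef k ℓ r s t φ ψ (2 + m) ≡ coef k′ ℓ′ r′ s′ (tailV t) φ′ ψ′ (1 + m)
coef-drop-first k ℓ φ ψ k′ ℓ′ φ′ ψ′ t {r} {s} h₁≡1 t₁≡1 h-shift ε-shift zero =
  trans (coef-two {k} {ℓ} {r} {s} {t} {φ} {ψ} h₁≡1 t₁≡1)
        (cong (λ x → binom (t 2 - + 1) (x - + 1)) (sym (h-shift 1 (s≤s z≤n))))
coef-drop-first k ℓ φ ψ k′ ℓ′ φ′ ψ′ t {r} {s} {r′} {s′} h₁≡1 t₁≡1 h-shift ε-shift (suc m)
  with eps k φ (3 + m) ≟ᵇ eps k φ (2 + m)
... | yes ε≡ = trans (coef-same k ℓ r s t φ ψ (suc m) ε≡)
               (trans (cong (λ x → binom (t (3 + m) - + 1) (x - + 1)) (sym (h-shift (2 + m) (s≤s z≤n))))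
                      (sym (coef-same k′ ℓ′ r′ s′ (tailV t) φ′ ψ′ m ε′≡)))
  where
  ε′≡ : eps k′ φ′ (2 + m) ≡ eps k′ φ′ (1 + m)
  ε′≡ = trans (ε-shift (2 + m) (s≤s z≤n)) (trans ε≡ (sym (ε-shift (1 + m) (s≤s z≤n))))
... | no ε≢ = trans (coef-switch k ℓ r s t φ ψ (suc m) ε≢)
              (trans (cong (binom (t (3 + m) - + 1)) psum-diff)
                     (sym (coef-switch k′ ℓ′ r′ s′ (tailV t) φ′ ψ′ m ε′≢)))
  where
  open ≡-Reasoning
  n = 2 + m
  h = hvec k ℓ r s φ ψ
  h′ = hvec k′ ℓ′ r′ s′ φ′ ψ′
  ε′≢ : eps k′ φ′ (2 + m) ≢ eps k′ φ′ (1 + m)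
  ε′≢ ε′≡ =
    ε≢ (trans (sym (ε-shift (2 + m) (s≤s z≤n))) (trans ε′≡ (ε-shift (1 + m) (s≤s z≤n))))
  cancel : ∀ u A B → (u +ℤ A) - (u +ℤ B) ≡ A - B
  cancel = solve-∀
  psum-diff : psum t (suc n) - psum h (suc n) ≡ psum (tailV t) n - psum h′ n
  psum-diff = begin
    psum t (suc n) - psum h (suc n)
      ≡⟨ cong₂ _-_ (psum-suc t n) (psum-suc h n) ⟩
    (t 1 +ℤ psum (tailV t) n) - (h 1 +ℤ psum (tailV h) n)
      ≡⟨ cong₂ (λ u v → (u +ℤ psum (tailV t) n) - (v +ℤ psum (tailV h) n)) t₁≡1 h₁≡1 ⟩
    (+ 1 +ℤ psum (tailV t) n) - (+ 1 +ℤ psum (tailV h) n)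
      ≡⟨ cancel (+ 1) (psum (tailV t) n) (psum (tailV h) n) ⟩
    psum (tailV t) n - psum (tailV h) n
      ≡⟨ cong (λ x → psum (tailV t) n - x) (psum-cong (λ j 1≤j → sym (h-shift j 1≤j)) n) ⟩
    psum (tailV t) n - psum h′ n ∎

coef-drop-φ₁ : ∀ k ℓ r s t φ ψ → φ 1 ≡ 1 → hvec (suc k) ℓ r s φ ψ 1 ≡ + 1 → t 1 ≡ + 1 →
  ∀ m → coef (suc k) ℓ r s t φ ψ (2 + m) ≡ coef k ℓ (tailV r) s (tailV t) (checkM φ) (barM ψ) (1 + m)
coef-drop-φ₁ k ℓ r s t φ ψ φ₁≡1 h₁≡1 t₁≡1 =
  coef-drop-first (suc k) ℓ φ ψ k ℓ (checkM φ) (barM ψ) t h₁≡1 t₁≡1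
    (hvec-drop-φ₁ k ℓ r s φ ψ φ₁≡1) (eps-drop-φ₁ k φ φ₁≡1)

coef-drop-ψ₁ : ∀ k ℓ r s t φ ψ → ψ 1 ≡ 1 → hvec k (suc ℓ) r s φ ψ 1 ≡ + 1 → t 1 ≡ + 1 →
  ∀ m → coef k (suc ℓ) r s t φ ψ (2 + m) ≡ coef k ℓ r (tailV s) (tailV t) (barM φ) (checkM ψ) (1 + m)
coef-drop-ψ₁ k ℓ r s t φ ψ ψ₁≡1 h₁≡1 t₁≡1 =
  coef-drop-first k (suc ℓ) φ ψ k ℓ (barM φ) (checkM ψ) t h₁≡1 t₁≡1
    (hvec-drop-ψ₁ k ℓ r s φ ψ ψ₁≡1) (eps-drop-ψ₁ k φ)

module Shuffle {k ℓ : ℕ} {φ ψ : ℕ → ℕ} (1≤k : 1 ≤ k) (1≤ℓ : 1 ≤ ℓ) (I : InI k ℓ φ ψ) where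

  private
    φ-range  = proj₁ (proj₁ I)
    φ-inc    = proj₂ (proj₁ I)
    ψ-range  = proj₁ (proj₁ (proj₂ I))
    ψ-inc    = proj₂ (proj₁ (proj₂ I))
    disjoint = proj₁ (proj₂ (proj₂ I))
    cover    = proj₂ (proj₂ (proj₂ I))

  1≤φ₁ : 1 ≤ φ 1
  1≤φ₁ = proj₁ (φ-range 1 ℕ.≤-refl 1≤k)

  1≤ψ₁ : 1 ≤ ψ 1
  1≤ψ₁ = proj₁ (ψ-range 1 ℕ.≤-refl 1≤ℓ)

  ψ₁≤k+ℓ : ψ 1 ≤ k + ℓ
  ψ₁≤k+ℓ = proj₂ (ψ-range 1 ℕ.≤-refl 1≤ℓ)

  preim-φ₁ : preim k φ (φ 1) ≡ just 1
  preim-φ₁ = preim-image k φ φ-inc 1 ℕ.≤-refl 1≤k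

  preim-ψ₁ : preim ℓ ψ (ψ 1) ≡ just 1
  preim-ψ₁ = preim-image ℓ ψ ψ-inc 1 ℕ.≤-refl 1≤ℓ

  ψ₁∉imφ : preim k φ (ψ 1) ≡ nothing
  ψ₁∉imφ = preim-nothing k φ (ψ 1) (λ j 1≤j j≤k → disjoint j 1 1≤j j≤k ℕ.≤-refl 1≤ℓ)

  eps-switches-at-φ₁ : SwitchesAt (eps k φ) false (φ 1)
  eps-switches-at-φ₁ = below , cong is-just preim-φ₁
    where
    below : ∀ i → 1 ≤ i → i ℕ.< φ 1 → eps k φ i ≡ false
    below i _ i<φ₁ = cong is-just (preim-nothing k φ i λ j 1≤j j≤k φj≡i →
      ℕ.<⇒≱ (subst (ℕ._< φ 1) (sym φj≡i) i<φ₁) (increasing-≥-first φ-inc j 1≤j j≤k))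

  eps-switches-at-ψ₁ : SwitchesAt (eps k φ) true (ψ 1)
  eps-switches-at-ψ₁ = below , cong is-just ψ₁∉imφ
    where
    below : ∀ i → 1 ≤ i → i ℕ.< ψ 1 → eps k φ i ≡ true
    below i 1≤i i<ψ₁ with cover i 1≤i (ℕ.<⇒≤ (ℕ.<-≤-trans i<ψ₁ ψ₁≤k+ℓ))
    ... | inj₁ (j , 1≤j , j≤k , φj≡i) = preim-complete k φ i j 1≤j j≤k φj≡i
    ... | inj₂ (j , 1≤j , j≤ℓ , ψj≡i) =
      ⊥-elim (ℕ.<⇒≱ (subst (ℕ._< ψ 1) (sym ψj≡i) i<ψ₁) (increasing-≥-first ψ-inc j 1≤j j≤ℓ))

  hvec-at-1-φ : φ 1 ≡ 1 → ∀ r s → hvec k ℓ r s φ ψ 1 ≡ r 1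
  hvec-at-1-φ φ₁≡1 r s =
    hvec-at-φ k ℓ r s φ ψ (subst (λ x → preim k φ x ≡ just 1) φ₁≡1 preim-φ₁)

  hvec-at-1-ψ : ψ 1 ≡ 1 → ∀ r s → hvec k ℓ r s φ ψ 1 ≡ s 1
  hvec-at-1-ψ ψ₁≡1 r s = hvec-at-ψ k ℓ r s φ ψ
    (subst (λ x → preim k φ x ≡ nothing) ψ₁≡1 ψ₁∉imφ)
    (subst (λ x → preim ℓ ψ x ≡ just 1) ψ₁≡1 preim-ψ₁)

  hvec-subE1-r : ∀ r s a → SubAt (φ 1) a (hvec k ℓ r s φ ψ) (hvec k ℓ (subE1 r a) s φ ψ)
  hvec-subE1-r r s a =
    away , trans (hvec-at-φ k ℓ (subE1 r a) s φ ψ preim-φ₁)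
                 (cong (_- a) (sym (hvec-at-φ k ℓ r s φ ψ preim-φ₁)))
    where
    away : ∀ x → x ≢ φ 1 → hvec k ℓ (subE1 r a) s φ ψ x ≡ hvec k ℓ r s φ ψ x
    away x x≢φ₁ = hvec-cong-r k ℓ s φ ψ x λ j _ _ φj≡x →
      proj₁ (subE1-SubAt r a) j (λ j≡1 → x≢φ₁ (trans (sym φj≡x) (cong φ j≡1)))

  hvec-subE1-s : ∀ r s b → SubAt (ψ 1) b (hvec k ℓ r s φ ψ) (hvec k ℓ r (subE1 s b) φ ψ)
  hvec-subE1-s r s b =
    away , trans (hvec-at-ψ k ℓ r (subE1 s b) φ ψ ψ₁∉imφ preim-ψ₁)
                 (cong (_- b) (sym (hvec-at-ψ k ℓ r s φ ψ ψ₁∉imφ preim-ψ₁)))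
    where
    away : ∀ x → x ≢ ψ 1 → hvec k ℓ r (subE1 s b) φ ψ x ≡ hvec k ℓ r s φ ψ x
    away x x≢ψ₁ = hvec-cong-s k ℓ r φ ψ x λ j _ _ ψj≡x →
      proj₁ (subE1-SubAt s b) j (λ j≡1 → x≢ψ₁ (trans (sym ψj≡x) (cong ψ j≡1)))

  coef-subE1-r : ∀ r s t a m →
    coef k ℓ (subE1 r a) s (subE1 t a) φ ψ (2 + m) ≡ coef k ℓ r s t φ ψ (2 + m)
  coef-subE1-r r s t a = coef-SubAt k ℓ φ ψ t 1≤φ₁ (hvec-subE1-r r s a) eps-switches-at-φ₁

  coef-subE1-s : ∀ r s t b m →
    coef k ℓ r (subE1 s b) (subE1 t b) φ ψ (2 + m) ≡ coef k ℓ r s t φ ψ (2 + m)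
  coef-subE1-s r s t b = coef-SubAt k ℓ φ ψ t 1≤ψ₁ (hvec-subE1-s r s b) eps-switches-at-ψ₁

lemma3p5 : (k ℓ : ℕ) → 1 ≤ k → 1 ≤ ℓ →
    (r s t : ℕ → ℤ) → Pos k r → Pos ℓ s → Pos (k + ℓ) t →
    psum r k +ℤ psum s ℓ ≡ psum t (k + ℓ) →
    (φ ψ : ℕ → ℕ) → InI k ℓ φ ψ →
    ((a b : ℤ) → a < t 1 ⊓ r 1 → b < t 1 ⊓ s 1 →
      (i : ℕ) → 2 ≤ i → i ≤ k + ℓ →
        (coef k ℓ (subE1 r a) s (subE1 t a) φ ψ i ≡ coef k ℓ r s t φ ψ i)
        × (coef k ℓ r (subE1 s b) (subE1 t b) φ ψ i ≡ coef k ℓ r s t φ ψ i))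
    × ((φ 1 ≡ 1 → r 1 ≡ + 1 → t 1 ≡ + 1 →
        (i : ℕ) → 1 ≤ i → i ≤ k + ℓ ∸ 1 →
          coef k ℓ r s t φ ψ (1 + i)
            ≡ coef (k ∸ 1) ℓ (tailV r) s (tailV t) (checkM φ) (barM ψ) i)
      × (ψ 1 ≡ 1 → s 1 ≡ + 1 → t 1 ≡ + 1 →
        (i : ℕ) → 1 ≤ i → i ≤ k + ℓ ∸ 1 →
          coef k ℓ r s t φ ψ (1 + i)
            ≡ coef k (ℓ ∸ 1) r (tailV s) (tailV t) (barM φ) (checkM ψ) i))
lemma3p5 (suc k) (suc ℓ) 1≤k 1≤ℓ r s t _ _ _ _ φ ψ I =
  (λ { a b _ _ (suc (suc m)) _ _ → coef-subE1-r r s t a m , coef-subE1-s r s t b m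
     ; _ _ _ _ (suc zero) (s≤s ()) _ })
  , (λ { φ₁≡1 r₁≡1 t₁≡1 (suc m) _ _ →
         coef-drop-φ₁ k (suc ℓ) r s t φ ψ φ₁≡1 (trans (hvec-at-1-φ φ₁≡1 r s) r₁≡1) t₁≡1 m })
  , (λ { ψ₁≡1 s₁≡1 t₁≡1 (suc m) _ _ →
         coef-drop-ψ₁ (suc k) ℓ r s t φ ψ ψ₁≡1 (trans (hvec-at-1-ψ ψ₁≡1 r s) s₁≡1) t₁≡1 m })
  where open Shuffle 1≤k 1≤ℓ I
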